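{- Let $B\ge 3$ be odd, $d=(B+1)/2$, and $r$ an integer with $1\le r<B/2$. Then $r$ is an eigenvalue of the matrix $A(B,r)$, and $A(B,r)$ has an entrywise positive left eigenvector corresponding to $r$.
   Context: $A(B,r)$ is the $d\times d$ real matrix whose rows and columns are indexed by $\{d,d+1,\dots,B\}$, with entries (all unspecified entries are $0$): row $d$: $A_{d,d}=-d$, $A_{d,B+1-r}=2(B+1-r)$, and $A_{d,k}=k$ for $B+1-r<k\le B$; for $d<k\le d+r-1$: $A_{k,k}=-k$ and $A_{k,d+k-r}=d+k-r$; for $d+r\le k\le B$: $A_{k,k}=-k$ and $A_{k,k-r}=k-r$. -}

module Defs where

open import Data.Nat as ℕ using (ℕ; zero; suc; _≡ᵇ_; _≤ᵇ_; _<ᵇ_; _∸_)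
open import Data.Nat.DivMod using (_/_)
open import Data.Bool using (Bool; true; false; if_then_else_; _∧_)
open import Data.Integer as ℤ using (ℤ; +_)
open import Data.Rational as ℚ using (ℚ; 0ℚ)
open import Data.Fin using (Fin; toℕ)
import Data.Fin as Fin
open import Data.Product using (Σ; ∃; _×_)
open import Relation.Binary.PropositionalEquality using (_≡_; _≢_)

dOf : ℕ → ℕ
dOf B = suc B / 2

-- The entry A_{j,k} of A(B,r), with j,k the actual indices in {d,…,B}.
entry : (B r j k : ℕ) → ℤ
entry B r j k =
  if j ≡ᵇ d then
    (if k ≡ᵇ d then ℤ.- (+ d)
     else if k ≡ᵇ c then + (2 ℕ.* c)
     else if (c <ᵇ k) ∧ (k ≤ᵇ B) then + k
     else + 0)
  else if (d <ᵇ j) ∧ (j ≤ᵇ d ℕ.+ r ∸ 1) then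
    (if k ≡ᵇ j then ℤ.- (+ j)
     else if k ≡ᵇ (d ℕ.+ j ∸ r) then + (d ℕ.+ j ∸ r)
     else + 0)
  else if (d ℕ.+ r ≤ᵇ j) ∧ (j ≤ᵇ B) then
    (if k ≡ᵇ j then ℤ.- (+ j)
     else if k ≡ᵇ (j ∸ r) then + (j ∸ r)
     else + 0)
  else + 0
  where
    d = dOf B
    c = suc B ∸ r

A : (B r : ℕ) → Fin (dOf B) → Fin (dOf B) → ℚ
A B r i k = entry B r (dOf B ℕ.+ toℕ i) (dOf B ℕ.+ toℕ k) ℚ./ 1

∑ : {n : ℕ} → (Fin n → ℚ) → ℚ
∑ {zero} f = 0ℚ
∑ {suc n} f = f Fin.zero ℚ.+ ∑ (λ i → f (Fin.suc i))

mulVec : {n : ℕ} → (Fin n → Fin n → ℚ) → (Fin n → ℚ) → Fin n → ℚ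
mulVec M v i = ∑ (λ k → M i k ℚ.* v k)

vecMul : {n : ℕ} → (Fin n → ℚ) → (Fin n → Fin n → ℚ) → Fin n → ℚ
vecMul w M k = ∑ (λ i → w i ℚ.* M i k)

NonZeroVec : {n : ℕ} → (Fin n → ℚ) → Set
NonZeroVec v = ∃ λ i → v i ≢ 0ℚ

IsEigenvalue : {n : ℕ} → (Fin n → Fin n → ℚ) → ℚ → Set
IsEigenvalue M λ′ = ∃ λ v → NonZeroVec v × (∀ i → mulVec M v i ≡ λ′ ℚ.* v i)

IsLeftEigenvector : {n : ℕ} → (Fin n → Fin n → ℚ) → ℚ → (Fin n → ℚ) → Set
IsLeftEigenvector M λ′ w = NonZeroVec w × (∀ k → vecMul w M k ≡ λ′ ℚ.* w k)

-- Write j ∈ {d,…,B} for the row/column indices and c = B + 1 − r.  Each row j ≠ d of A(B,r) has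
-- −j on the diagonal and σ j in column σ j, where σ is the cyclic shift j ↦ j − r of {d,…,B}
-- (so σ j = d + j − r for j < d + r); row d is −d e_d + c e_c + Σ_{k ≥ c} k e_k, and c = σ d.
-- Hence A_{jk} = k · ([k = σ j] − [k = j] + [j = d][c ≤ k]), and with w_j = j column k of wA is
-- k · (σ⁻¹ k − k + d [c ≤ k]) = r k, since σ⁻¹ k = k + r − d [c ≤ k].  So w > 0 is a left
-- eigenvector for r.  A left eigenvalue is an eigenvalue: if w_p ≠ 0, Gaussian elimination gives
-- v ≠ 0 solving the d − 1 equations of (A − r)v = 0 other than the p-th, and the p-th follows
-- from w (A − r) v = 0.
module Submission where

open import Defs
open import Algebra.Bundles using (CommutativeMonoid; CommutativeRing)
import Algebra.Properties.CommutativeMonoid.Sum as CommutativeMonoidSum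
import Algebra.Properties.Semiring.Sum as SemiringSum
open import Data.Bool using (true; false; if_then_else_)
open import Data.Empty using (⊥-elim)
open import Data.Fin as Fin using (Fin; zero; suc; punchIn; punchOut; toℕ; fromℕ<)
open import Data.Fin.Properties using (any?; punchInᵢ≢i; punchIn-punchOut; toℕ<n; toℕ-injective; toℕ-fromℕ<)
open import Data.Integer as ℤ using (ℤ; +_)
import Data.Integer.Properties as ℤP
open import Data.Integer.Tactic.RingSolver using (solve-∀)
open import Data.Nat as ℕ using (ℕ; zero; suc; _≤_; _<_; _≡ᵇ_; _≤ᵇ_; _<ᵇ_; _∸_; z≤n; s≤s)
import Data.Nat.Coprimality as Coprime
import Data.Nat.DivMod as DivMod
import Data.Nat.Properties as ℕP
import Data.Nat.Tactic.RingSolver as ℕ-Solver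
open import Data.Product using (∃; _×_; _,_)
open import Data.Rational as ℚ using (ℚ; 0ℚ; 1ℚ)
import Data.Rational.Properties as ℚP
open import Data.Rational.Solver using (module +-*-Solver)
open import Data.Sum using ([_,_]′; inj₁; inj₂)
open import Data.Vec.Functional using (Vector; removeAt)
open import Function using (_∘_)
open import Relation.Nullary using (Dec; does; proof; ¬_; yes; no; ¬?)
open import Relation.Nullary.Decidable using (decidable-stable; dec-true; dec-false)
open import Relation.Nullary.Reflects using (Reflects; ofʸ; ofⁿ)
open import Relation.Binary.PropositionalEquality
  using (_≡_; _≢_; refl; sym; trans; cong; cong₂; subst; subst₂; module ≡-Reasoning)

module _ {c ℓ} (M : CommutativeMonoid c ℓ) where
  open CommutativeMonoid M using (Carrier; _≈_; _∙_; ε; ∙-congˡ; identityʳ; setoid)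
  open CommutativeMonoidSum M using (sum; sum-remove; sum-cong-≋; sum-replicate-zero)
  open import Relation.Binary.Reasoning.Setoid setoid

  sum-single : ∀ {n} (f : Vector Carrier n) (p : Fin n) → (∀ i → i ≢ p → f i ≈ ε) → sum f ≈ f p
  sum-single {suc n} f p f≈ε = begin
    sum f                         ≈⟨ sum-remove f ⟩
    f p ∙ sum {n} (removeAt f p)  ≈⟨ ∙-congˡ (sum-cong-≋ (λ i → f≈ε _ (punchInᵢ≢i p i))) ⟩
    f p ∙ sum {n} (λ _ → ε)       ≈⟨ ∙-congˡ (sum-replicate-zero n) ⟩
    f p ∙ ε                       ≈⟨ identityʳ (f p) ⟩
    f p                           ∎

  sum-single-toℕ : ∀ {n} (g : ℕ → Carrier) {p} → p < n → (∀ x → x < n → x ≢ p → g x ≈ ε) →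
                   sum (λ (i : Fin n) → g (toℕ i)) ≈ g p
  sum-single-toℕ {n} g {p} p<n g≈ε = begin
    sum {n} (g ∘ toℕ)     ≈⟨ sum-single (g ∘ toℕ) (fromℕ< p<n) vanish ⟩
    g (toℕ (fromℕ< p<n))  ≡⟨ cong g (toℕ-fromℕ< p<n) ⟩
    g p                   ∎
    where
    vanish : ∀ i → i ≢ fromℕ< p<n → g (toℕ i) ≈ ε
    vanish i i≢p = g≈ε (toℕ i) (toℕ<n i) (λ i≡p → i≢p (toℕ-injective (trans i≡p (sym (toℕ-fromℕ< p<n)))))

module LinearAlgebra where
  open import Data.Rational using (_+_; _*_; -_; _-_; 1/_)
  open import Algebra.Properties.Group ℚP.+-0-group using (x∙y⁻¹≈ε⇒x≈y)
  open SemiringSum (CommutativeRing.semiring ℚP.+-*-commutativeRing)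
    using (sum; sum-cong-≗; sum-replicate-zero; ∑-distrib-+; ∑-comm; *-distribˡ-sum; *-distribʳ-sum)
  open +-*-Solver using (solve; _:=_; _:+_; _:-_; _:*_; :-_; con)

  ∑≡sum : ∀ {n} (f : Fin n → ℚ) → ∑ f ≡ sum f
  ∑≡sum {zero}  f = refl
  ∑≡sum {suc n} f = cong (λ x → f zero + x) (∑≡sum (f ∘ suc))

  dot : ∀ {n} → (Fin n → ℚ) → (Fin n → ℚ) → ℚ
  dot u v = sum (λ k → u k * v k)

  dot-linear : ∀ {n} (u u′ v : Fin n → ℚ) q → dot (λ k → u k - q * u′ k) v ≡ dot u v - q * dot u′ v
  dot-linear u u′ v q = begin
    sum (λ k → (u k - q * u′ k) * v k)
      ≡⟨ sum-cong-≗ (λ k → expand (u k) (u′ k) (v k) q) ⟩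
    sum (λ k → u k * v k + - q * (u′ k * v k))
      ≡⟨ ∑-distrib-+ (λ k → u k * v k) (λ k → - q * (u′ k * v k)) ⟩
    dot u v + sum (λ k → - q * (u′ k * v k))
      ≡⟨ cong (λ x → dot u v + x) (*-distribˡ-sum (- q) (λ k → u′ k * v k)) ⟨
    dot u v + - q * dot u′ v
      ≡⟨ collect (dot u v) q (dot u′ v) ⟩
    dot u v - q * dot u′ v
      ∎
    where
    open ≡-Reasoning
    expand : ∀ a b x q → (a - q * b) * x ≡ a * x + - q * (b * x)
    expand = solve 4 (λ a b x q → (a :- q :* b) :* x := a :* x :+ (:- q) :* (b :* x)) refl
    collect : ∀ a q b → a + - q * b ≡ a - q * b
    collect = solve 3 (λ a q b → a :+ (:- q) :* b := a :- q :* b) refl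

  dot-assoc : ∀ {m n} (w : Fin m → ℚ) (M : Fin m → Fin n → ℚ) (v : Fin n → ℚ) →
              dot w (λ i → dot (M i) v) ≡ dot (λ k → dot w (λ i → M i k)) v
  dot-assoc w M v = begin
    sum (λ i → w i * sum (λ k → M i k * v k))
      ≡⟨ sum-cong-≗ (λ i → *-distribˡ-sum (w i) (λ k → M i k * v k)) ⟩
    sum (λ i → sum (λ k → w i * (M i k * v k)))
      ≡⟨ ∑-comm (λ i k → w i * (M i k * v k)) ⟩
    sum (λ k → sum (λ i → w i * (M i k * v k)))
      ≡⟨ sum-cong-≗ (λ k → sum-cong-≗ (λ i → ℚP.*-assoc (w i) (M i k) (v k))) ⟨
    sum (λ k → sum (λ i → w i * M i k * v k))
      ≡⟨ sum-cong-≗ (λ k → *-distribʳ-sum (v k) (λ i → w i * M i k)) ⟨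
    sum (λ k → sum (λ i → w i * M i k) * v k)
      ∎
    where open ≡-Reasoning

  unit₀ : ∀ {n} → Fin (suc n) → ℚ
  unit₀ zero    = 1ℚ
  unit₀ (suc _) = 0ℚ

  unit₀≢0 : ∀ {n} → NonZeroVec (unit₀ {n})
  unit₀≢0 = zero , λ ()

  dot-unit₀ : ∀ {n} (u : Fin (suc n) → ℚ) → u zero ≡ 0ℚ → dot u unit₀ ≡ 0ℚ
  dot-unit₀ {n} u u₀≡0 = cong₂ _+_ (trans (ℚP.*-identityʳ (u zero)) u₀≡0)
    (trans (sum-cong-≗ (λ k → ℚP.*-zeroʳ (u (suc k)))) (sum-replicate-zero n))

  module Elimination {m} (M : Fin (suc m) → Fin (suc (suc m)) → ℚ) (p : Fin (suc m))
                     .{{_ : ℚ.NonZero (M p zero)}} where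

    factor : Fin (suc m) → ℚ
    factor i = M i zero * 1/ M p zero

    reduced : Fin m → Fin (suc m) → ℚ
    reduced i k = M (punchIn p i) (suc k) - factor (punchIn p i) * M p (suc k)

    extend : (Fin (suc m) → ℚ) → Fin (suc (suc m)) → ℚ
    extend v zero    = - (dot (M p ∘ suc) v * 1/ M p zero)
    extend v (suc k) = v k

    dot-extend : ∀ v i → dot (M i) (extend v) ≡ dot (M i ∘ suc) v - factor i * dot (M p ∘ suc) v
    dot-extend v i = rearrange (M i zero) (1/ M p zero) (dot (M p ∘ suc) v) (dot (M i ∘ suc) v)
      where
      rearrange : ∀ a z s t → a * - (s * z) + t ≡ t - a * z * s
      rearrange = solve 4 (λ a z s t → a :* (:- (s :* z)) :+ t := t :- a :* z :* s) refl

    extend-solves : ∀ v → (∀ i → dot (reduced i) v ≡ 0ℚ) → ∀ i → dot (M i) (extend v) ≡ 0ℚ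
    extend-solves v reduced-solved i with i Fin.≟ p
    ... | yes refl = begin
      dot (M p) (extend v)                              ≡⟨ dot-extend v p ⟩
      dot (M p ∘ suc) v - factor p * dot (M p ∘ suc) v ≡⟨ cong (λ x → dot (M p ∘ suc) v - x * dot (M p ∘ suc) v)
                                                                (ℚP.*-inverseʳ (M p zero)) ⟩
      dot (M p ∘ suc) v - 1ℚ * dot (M p ∘ suc) v       ≡⟨ cancel (dot (M p ∘ suc) v) ⟩
      0ℚ                                                ∎
      where
      open ≡-Reasoning
      cancel : ∀ s → s - 1ℚ * s ≡ 0ℚ
      cancel = solve 1 (λ s → s :- con 1ℚ :* s := con 0ℚ) refl
    ... | no i≢p = subst (λ i → dot (M i) (extend v) ≡ 0ℚ) (punchIn-punchOut p≢i) (begin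
      dot (M I) (extend v)                              ≡⟨ dot-extend v I ⟩
      dot (M I ∘ suc) v - factor I * dot (M p ∘ suc) v ≡⟨ dot-linear (M I ∘ suc) (M p ∘ suc) v (factor I) ⟨
      dot (reduced (punchOut p≢i)) v                    ≡⟨ reduced-solved (punchOut p≢i) ⟩
      0ℚ                                                ∎)
      where
      open ≡-Reasoning
      p≢i : p ≢ i
      p≢i = i≢p ∘ sym
      I = punchIn p (punchOut p≢i)

  nonzero-solution : ∀ m (M : Fin m → Fin (suc m) → ℚ) → ∃ λ v → NonZeroVec v × (∀ i → dot (M i) v ≡ 0ℚ)
  nonzero-solution zero    M = unit₀ , unit₀≢0 , λ ()
  nonzero-solution (suc m) M with any? (λ i → ¬? (M i zero ℚ.≟ 0ℚ))
  ... | no no-pivot = unit₀ , unit₀≢0 , λ i →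
    dot-unit₀ (M i) (decidable-stable (M i zero ℚ.≟ 0ℚ) (λ Mi0≢0 → no-pivot (i , Mi0≢0)))
  ... | yes (p , pivot≢0) =
    let v , (j , vj≢0) , reduced-solved = nonzero-solution m reduced
    in  extend v , (suc j , vj≢0) , extend-solves v reduced-solved
    where
    instance _ = ℚ.≢-nonZero pivot≢0
    open Elimination M p

  δ : ∀ {n} → Fin n → Fin n → ℚ
  δ i k = if does (i Fin.≟ k) then 1ℚ else 0ℚ

  dot-δ : ∀ {n} (i : Fin n) (v : Fin n → ℚ) → dot (δ i) v ≡ v i
  dot-δ i v = begin
    sum (λ k → δ i k * v k) ≡⟨ sum-single ℚP.+-0-commutativeMonoid (λ k → δ i k * v k) i off-diagonal ⟩
    δ i i * v i             ≡⟨ cong (λ b → (if b then 1ℚ else 0ℚ) * v i) (dec-true (i Fin.≟ i) refl) ⟩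
    1ℚ * v i                ≡⟨ ℚP.*-identityˡ (v i) ⟩
    v i                     ∎
    where
    open ≡-Reasoning
    off-diagonal : ∀ k → k ≢ i → δ i k * v k ≡ 0ℚ
    off-diagonal k k≢i rewrite dec-false (i Fin.≟ k) (k≢i ∘ sym) = ℚP.*-zeroˡ (v k)

  x*y≡0⇒y≡0 : ∀ x y → x ≢ 0ℚ → x * y ≡ 0ℚ → y ≡ 0ℚ
  x*y≡0⇒y≡0 x y x≢0 xy≡0 = begin
    y              ≡⟨ ℚP.*-identityˡ y ⟨
    1ℚ * y         ≡⟨ cong (_* y) (ℚP.*-inverseˡ x) ⟨
    1/ x * x * y   ≡⟨ ℚP.*-assoc (1/ x) x y ⟩
    1/ x * (x * y) ≡⟨ cong (1/ x *_) xy≡0 ⟩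
    1/ x * 0ℚ      ≡⟨ ℚP.*-zeroʳ (1/ x) ⟩
    0ℚ             ∎
    where
    open ≡-Reasoning
    instance _ = ℚ.≢-nonZero x≢0

  module _ {n} (M : Fin n → Fin n → ℚ) (λ′ : ℚ) where

    residual : (Fin n → ℚ) → Fin n → ℚ
    residual v i = dot (M i) v - λ′ * v i

    residual-shifted : ∀ v i → dot (λ k → M i k - λ′ * δ i k) v ≡ residual v i
    residual-shifted v i = trans (dot-linear (M i) (δ i) v λ′) (cong (λ x → dot (M i) v - λ′ * x) (dot-δ i v))

    dot-residual≡0 : ∀ {w} → (∀ k → vecMul w M k ≡ λ′ * w k) → ∀ v → dot w (residual v) ≡ 0ℚ
    dot-residual≡0 {w} wM≡λw v = begin
      sum (λ i → w i * (dot (M i) v - λ′ * v i))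
        ≡⟨ sum-cong-≗ (λ i → expand (w i) (dot (M i) v) λ′ (v i)) ⟩
      sum (λ i → w i * dot (M i) v + - λ′ * (w i * v i))
        ≡⟨ ∑-distrib-+ (λ i → w i * dot (M i) v) (λ i → - λ′ * (w i * v i)) ⟩
      dot w (λ i → dot (M i) v) + sum (λ i → - λ′ * (w i * v i))
        ≡⟨ cong₂ _+_ (dot-assoc w M v) (sym (*-distribˡ-sum (- λ′) (λ i → w i * v i))) ⟩
      dot (λ k → dot w (λ i → M i k)) v + - λ′ * dot w v
        ≡⟨ cong (_+ - λ′ * dot w v) (sum-cong-≗ wM≡λw′) ⟩
      sum (λ k → λ′ * w k * v k) + - λ′ * dot w v
        ≡⟨ cong (_+ - λ′ * dot w v) (sum-cong-≗ (λ k → ℚP.*-assoc λ′ (w k) (v k))) ⟩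
      sum (λ k → λ′ * (w k * v k)) + - λ′ * dot w v
        ≡⟨ cong (_+ - λ′ * dot w v) (*-distribˡ-sum λ′ (λ k → w k * v k)) ⟨
      λ′ * dot w v + - λ′ * dot w v
        ≡⟨ cancel λ′ (dot w v) ⟩
      0ℚ
        ∎
      where
      open ≡-Reasoning
      wM≡λw′ : ∀ k → dot w (λ i → M i k) * v k ≡ λ′ * w k * v k
      wM≡λw′ k = cong (_* v k) (trans (sym (∑≡sum (λ i → w i * M i k))) (wM≡λw k))
      expand : ∀ a x l y → a * (x - l * y) ≡ a * x + - l * (a * y)
      expand = solve 4 (λ a x l y → a :* (x :- l :* y) := a :* x :+ (:- l) :* (a :* y)) refl
      cancel : ∀ l s → l * s + - l * s ≡ 0ℚ
      cancel = solve 2 (λ l s → l :* s :+ (:- l) :* s := con 0ℚ) refl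

    residual-redundant : ∀ {w p v} → w p ≢ 0ℚ → (∀ k → vecMul w M k ≡ λ′ * w k) →
                         (∀ i → i ≢ p → residual v i ≡ 0ℚ) → residual v p ≡ 0ℚ
    residual-redundant {w} {p} {v} wp≢0 wM≡λw off-p = x*y≡0⇒y≡0 (w p) (residual v p) wp≢0 (begin
      w p * residual v p ≡⟨ sum-single ℚP.+-0-commutativeMonoid (λ i → w i * residual v i) p
                              (λ i i≢p → trans (cong (w i *_) (off-p i i≢p)) (ℚP.*-zeroʳ (w i))) ⟨
      dot w (residual v) ≡⟨ dot-residual≡0 wM≡λw v ⟩
      0ℚ                 ∎)
      where open ≡-Reasoning

  leftEigenvector⇒eigenvalue : ∀ {n} (M : Fin n → Fin n → ℚ) (λ′ : ℚ) (w : Fin n → ℚ) →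
                               IsLeftEigenvector M λ′ w → IsEigenvalue M λ′
  leftEigenvector⇒eigenvalue {suc m} M λ′ w ((p , wp≢0) , wM≡λw)
    with nonzero-solution m (λ i k → M (punchIn p i) k - λ′ * δ (punchIn p i) k)
  ... | v , v≢0 , rows-solved = v , v≢0 , λ i →
    trans (∑≡sum (λ k → M i k * v k)) (x∙y⁻¹≈ε⇒x≈y _ _ (residual≡0 i))
    where
    off-p : ∀ i → i ≢ p → residual M λ′ v i ≡ 0ℚ
    off-p i i≢p = subst (λ i → residual M λ′ v i ≡ 0ℚ) (punchIn-punchOut (i≢p ∘ sym))
      (trans (sym (residual-shifted M λ′ v _)) (rows-solved _))
    residual≡0 : ∀ i → residual M λ′ v i ≡ 0ℚ
    residual≡0 i with i Fin.≟ p
    ... | yes refl = residual-redundant M λ′ wp≢0 wM≡λw off-p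
    ... | no i≢p   = off-p i i≢p

module ColumnSums where
  open import Data.Nat using (_+_)
  open SemiringSum ℤP.+-*-semiring using (sum; sum-cong-≗; ∑-distrib-+; *-distribˡ-sum)

  χ : ∀ {a} {P : Set a} → Dec P → ℤ
  χ P? = if does P? then + 1 else + 0

  χ-yes : ∀ {a} {P : Set a} (P? : Dec P) → P → χ P? ≡ + 1
  χ-yes P? p rewrite dec-true P? p = refl

  χ-no : ∀ {a} {P : Set a} (P? : Dec P) → ¬ P → χ P? ≡ + 0
  χ-no P? ¬p rewrite dec-false P? ¬p = refl

  ≡ᵇ-reflects-≡ : ∀ m n → Reflects (m ≡ n) (m ≡ᵇ n)
  ≡ᵇ-reflects-≡ m n = proof (m ℕP.≟ n)

  <⇒≤∸1 : ∀ {m n} → m < n → m ≤ n ∸ 1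
  <⇒≤∸1 {n = suc n} (s≤s m≤n) = m≤n

  ≤∸1⇒< : ∀ {m n} → 0 < n → m ≤ n ∸ 1 → m < n
  ≤∸1⇒< {n = suc n} _ m≤n = s≤s m≤n

  -- The form of every row of entry below row d once its block test has been decided.
  two-entry-row : ∀ {x j k} → x ≢ j →
    (if k ≡ᵇ j then ℤ.- (+ j) else if k ≡ᵇ x then + x else + 0)
    ≡ + k ℤ.* (χ (k ℕP.≟ x) ℤ.- χ (k ℕP.≟ j))
  two-entry-row {x} {j} {k} x≢j with k ≡ᵇ j | ≡ᵇ-reflects-≡ k j
  ... | true  | ofʸ refl =
    trans (negate (+ j)) (cong (λ z → + j ℤ.* (z ℤ.- + 1)) (sym (χ-no (j ℕP.≟ x) (x≢j ∘ sym))))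
    where
    negate : ∀ z → ℤ.- z ≡ z ℤ.* (+ 0 ℤ.- + 1)
    negate = solve-∀
  ... | false | ofⁿ _ with k ≡ᵇ x | ≡ᵇ-reflects-≡ k x
  ...   | true  | ofʸ refl = sym (ℤP.*-identityʳ (+ k))
  ...   | false | ofⁿ _    = sym (ℤP.*-zeroʳ (+ k))

  module _ {B r s : ℕ} (d≡r+s : dOf B ≡ r + s) (B+1≡d+d : suc B ≡ dOf B + dOf B)
           (0<r : 0 < r) (0<s : 0 < s) where

    d c : ℕ
    d = dOf B
    c = suc B ∸ r

    -- The block test is spelled exactly as in entry, so that one with-abstraction evaluates both.
    σ : ℕ → ℕ
    σ j = if j ≤ᵇ d + r ∸ 1 then d + j ∸ r else j ∸ r

    shape : ℕ → ℕ → ℤ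
    shape j k = χ (k ℕP.≟ σ j) ℤ.- χ (k ℕP.≟ j) ℤ.+ χ (j ℕP.≟ d) ℤ.* χ (c ℕP.≤? k)

    d+x∸r≡x+s : ∀ x → d + x ∸ r ≡ x + s
    d+x∸r≡x+s x = shift d≡r+s
      where
      shift : ∀ {e} → e ≡ r + s → e + x ∸ r ≡ x + s
      shift refl = trans (cong (_∸ r) (trans (ℕP.+-assoc r s x) (cong (λ y → r + y) (ℕP.+-comm s x))))
                         (ℕP.m+n∸m≡n r (x + s))

    c≡d+s : c ≡ d + s
    c≡d+s = trans (cong (_∸ r) B+1≡d+d) (d+x∸r≡x+s d)

    d<c : d < c
    d<c = subst (d <_) (sym c≡d+s) (ℕP.m<m+n d 0<s)

    r≤d : r ≤ d
    r≤d = subst (r ≤_) (sym d≡r+s) (ℕP.m≤m+n r s)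

    d+x≤B : ∀ {x} → x < d → d + x ≤ B
    d+x≤B {x} x<d = ℕP.≤-pred (subst (d + x <_) (sym B+1≡d+d) (ℕP.+-monoʳ-< d x<d))

    σd≡c : σ d ≡ c
    σd≡c with d ≤ᵇ d + r ∸ 1 | ℕP.≤ᵇ-reflects-≤ d (d + r ∸ 1)
    ... | true  | _              = cong (_∸ r) (sym B+1≡d+d)
    ... | false | ofⁿ d≰d+r∸1 = ⊥-elim (d≰d+r∸1 (<⇒≤∸1 (ℕP.m<m+n d 0<r)))

    σ-wrap : ∀ {x} → x < r → σ (d + x) ≡ d + (x + s)
    σ-wrap {x} x<r with d + x ≤ᵇ d + r ∸ 1 | ℕP.≤ᵇ-reflects-≤ (d + x) (d + r ∸ 1)
    ... | true  | _          = trans (d+x∸r≡x+s (d + x)) (ℕP.+-assoc d x s)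
    ... | false | ofⁿ d+x≰ = ⊥-elim (d+x≰ (<⇒≤∸1 (ℕP.+-monoʳ-< d x<r)))

    σ-shift : ∀ {x} → r ≤ x → σ (d + x) ≡ d + (x ∸ r)
    σ-shift {x} r≤x with d + x ≤ᵇ d + r ∸ 1 | ℕP.≤ᵇ-reflects-≤ (d + x) (d + r ∸ 1)
    ... | true  | ofʸ d+x≤ =
      ⊥-elim (ℕP.<⇒≱ (ℕP.+-cancelˡ-< d x r (≤∸1⇒< (ℕP.<-≤-trans 0<r (ℕP.m≤n+m r d)) d+x≤)) r≤x)
    ... | false | _          = ℕP.+-∸-assoc d r≤x

    entry-top : ∀ {k} → k ≤ B → entry B r d k ≡ + k ℤ.* shape d k
    entry-top {k} k≤B with d ≡ᵇ d | ≡ᵇ-reflects-≡ d d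
    ... | false | ofⁿ d≢d = ⊥-elim (d≢d refl)
    ... | true  | _ with k ≡ᵇ d | ≡ᵇ-reflects-≡ k d
    ...   | true  | ofʸ refl = sym (trans
            (cong₂ (λ a b → + d ℤ.* (a ℤ.- + 1 ℤ.+ + 1 ℤ.* b))
                   (χ-no (d ℕP.≟ σ d) (ℕP.<⇒≢ d<c ∘ (λ d≡σd → trans d≡σd σd≡c)))
                   (χ-no (c ℕP.≤? d) (ℕP.<⇒≱ d<c)))
            (negate (+ d)))
      where
      negate : ∀ z → z ℤ.* (+ 0 ℤ.- + 1 ℤ.+ + 1 ℤ.* + 0) ≡ ℤ.- z
      negate = solve-∀
    ...   | false | ofⁿ k≢d with k ≡ᵇ c | ≡ᵇ-reflects-≡ k c
    ...     | true  | ofʸ refl = sym (trans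
              (cong₂ (λ a b → + c ℤ.* (a ℤ.- + 0 ℤ.+ + 1 ℤ.* b))
                     (χ-yes (c ℕP.≟ σ d) (sym σd≡c))
                     (χ-yes (c ℕP.≤? c) ℕP.≤-refl))
              (trans (ℤP.*-comm (+ c) (+ 2)) (sym (ℤP.pos-* 2 c))))
    ...     | false | ofⁿ k≢c with c <ᵇ k | ℕP.<ᵇ-reflects-< c k
    ...       | false | ofⁿ c≮k = sym (trans
                (cong₂ (λ a b → + k ℤ.* (a ℤ.- + 0 ℤ.+ + 1 ℤ.* b))
                       (χ-no (k ℕP.≟ σ d) (k≢c ∘ (λ k≡σd → trans k≡σd σd≡c)))
                       (χ-no (c ℕP.≤? k) (λ c≤k → [ c≮k , k≢c ∘ sym ]′ (ℕP.m≤n⇒m<n∨m≡n c≤k))))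
                (ℤP.*-zeroʳ (+ k)))
    ...       | true  | ofʸ c<k with k ≤ᵇ B | ℕP.≤ᵇ-reflects-≤ k B
    ...         | false | ofⁿ k≰B = ⊥-elim (k≰B k≤B)
    ...         | true  | _       = sym (trans
                  (cong₂ (λ a b → + k ℤ.* (a ℤ.- + 0 ℤ.+ + 1 ℤ.* b))
                         (χ-no (k ℕP.≟ σ d) (k≢c ∘ (λ k≡σd → trans k≡σd σd≡c)))
                         (χ-yes (c ℕP.≤? k) (ℕP.<⇒≤ c<k)))
                  (ℤP.*-identityʳ (+ k)))

    entry-lower : ∀ {j k} → d < j → j ≤ B → entry B r j k ≡ + k ℤ.* shape j k
    entry-lower {j} {k} d<j j≤B with j ≡ᵇ d | ≡ᵇ-reflects-≡ j d
    ... | true  | ofʸ refl = ⊥-elim (ℕP.<-irrefl refl d<j)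
    ... | false | _ with d <ᵇ j | ℕP.<ᵇ-reflects-< d j
    ...   | false | ofⁿ d≮j = ⊥-elim (d≮j d<j)
    ...   | true  | _ with j ≤ᵇ d + r ∸ 1 | ℕP.≤ᵇ-reflects-≤ j (d + r ∸ 1)
    ...     | true  | _ = trans (two-entry-row {k = k} d+j∸r≢j) (cong (+ k ℤ.*_) (sym (ℤP.+-identityʳ _)))
      where
      d+j∸r≢j : d + j ∸ r ≢ j
      d+j∸r≢j e = ℕP.>⇒≢ (ℕP.m<m+n j 0<s) (trans (sym (d+x∸r≡x+s j)) e)
    ...     | false | ofⁿ j≰d+r∸1 with d + r ≤ᵇ j | ℕP.≤ᵇ-reflects-≤ (d + r) j
    ...       | false | ofⁿ d+r≰j = ⊥-elim (d+r≰j (ℕP.≮⇒≥ (j≰d+r∸1 ∘ <⇒≤∸1)))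
    ...       | true  | ofʸ d+r≤j with j ≤ᵇ B | ℕP.≤ᵇ-reflects-≤ j B
    ...         | false | ofⁿ j≰B = ⊥-elim (j≰B j≤B)
    ...         | true  | _       = trans (two-entry-row {k = k} j∸r≢j) (cong (+ k ℤ.*_) (sym (ℤP.+-identityʳ _)))
      where
      j∸r≢j : j ∸ r ≢ j
      j∸r≢j = ℕP.<⇒≢ (ℕP.∸-monoʳ-< 0<r (ℕP.≤-trans (ℕP.m≤n+m r d) d+r≤j))

    entry≡k*shape : ∀ {j k} → d ≤ j → j ≤ B → k ≤ B → entry B r j k ≡ + k ℤ.* shape j k
    entry≡k*shape {j} {k} d≤j j≤B k≤B with ℕP.m≤n⇒m<n∨m≡n d≤j
    ... | inj₁ d<j  = entry-lower {k = k} d<j j≤B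
    ... | inj₂ refl = entry-top k≤B

    record Preimage (y : ℕ) : Set where
      field
        index   : ℕ
        index<d : index < d
        σ-index : σ (d + index) ≡ d + y
        unique  : ∀ {x} → x < d → σ (d + x) ≡ d + y → x ≡ index
        balance : + (d + index) ℤ.+ + d ℤ.* χ (c ℕP.≤? d + y) ≡ + (d + y) ℤ.+ + r

    preimage-shift : ∀ {y} → y < s → Preimage y
    preimage-shift {y} y<s = record
      { index   = y + r
      ; index<d = subst (y + r <_) (sym (trans d≡r+s (ℕP.+-comm r s))) (ℕP.+-monoˡ-< r y<s)
      ; σ-index = trans (σ-shift (ℕP.m≤n+m r y)) (cong (λ z → d + z) (ℕP.m+n∸n≡m y r))
      ; unique  = unique
      ; balance = begin
          + (d + (y + r)) ℤ.+ + d ℤ.* χ (c ℕP.≤? d + y)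
            ≡⟨ cong (λ z → + (d + (y + r)) ℤ.+ + d ℤ.* z) (χ-no (c ℕP.≤? d + y) c≰d+y) ⟩
          + (d + (y + r)) ℤ.+ + d ℤ.* + 0
            ≡⟨ cong (λ z → + (d + (y + r)) ℤ.+ z) (ℤP.*-zeroʳ (+ d)) ⟩
          + (d + (y + r) + 0)
            ≡⟨ cong +_ (trans (ℕP.+-identityʳ _) (sym (ℕP.+-assoc d y r))) ⟩
          + (d + y + r)
            ∎
      }
      where
      open ≡-Reasoning
      c≰d+y : ¬ (c ≤ d + y)
      c≰d+y c≤d+y = ℕP.<⇒≱ (ℕP.+-monoʳ-< d y<s) (subst (_≤ d + y) c≡d+s c≤d+y)
      unique : ∀ {x} → x < d → σ (d + x) ≡ d + y → x ≡ y + r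
      unique {x} x<d σ≡ with x ℕP.<? r
      ... | yes x<r = ⊥-elim (ℕP.<⇒≱ y<s (subst (s ≤_) x+s≡y (ℕP.m≤n+m s x)))
        where
        x+s≡y : x + s ≡ y
        x+s≡y = ℕP.+-cancelˡ-≡ d _ _ (trans (sym (σ-wrap x<r)) σ≡)
      ... | no x≮r = trans (sym (ℕP.m∸n+n≡m r≤x)) (cong (_+ r) x∸r≡y)
        where
        r≤x = ℕP.≮⇒≥ x≮r
        x∸r≡y : x ∸ r ≡ y
        x∸r≡y = ℕP.+-cancelˡ-≡ d _ _ (trans (sym (σ-shift r≤x)) σ≡)

    preimage-wrap : ∀ {y} → s ≤ y → y < d → Preimage y
    preimage-wrap {y} s≤y y<d = record
      { index   = y ∸ s
      ; index<d = ℕP.<-≤-trans index<r r≤d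
      ; σ-index = trans (σ-wrap index<r) (cong (λ z → d + z) [y∸s]+s≡y)
      ; unique  = unique
      ; balance = begin
          + (d + (y ∸ s)) ℤ.+ + d ℤ.* χ (c ℕP.≤? d + y)
            ≡⟨ cong (λ z → + (d + (y ∸ s)) ℤ.+ + d ℤ.* z) (χ-yes (c ℕP.≤? d + y) c≤d+y) ⟩
          + (d + (y ∸ s)) ℤ.+ + d ℤ.* + 1
            ≡⟨ cong (λ z → + (d + (y ∸ s)) ℤ.+ z) (ℤP.*-identityʳ (+ d)) ⟩
          + (d + (y ∸ s) + d)
            ≡⟨ cong +_ (rearrange d≡r+s) ⟩
          + (d + y + r)
            ∎
      }
      where
      open ≡-Reasoning
      [y∸s]+s≡y : y ∸ s + s ≡ y
      [y∸s]+s≡y = ℕP.m∸n+n≡m s≤y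
      index<r : y ∸ s < r
      index<r = ℕP.+-cancelʳ-< s (y ∸ s) r (subst₂ _<_ (sym [y∸s]+s≡y) d≡r+s y<d)
      c≤d+y : c ≤ d + y
      c≤d+y = subst (_≤ d + y) (sym c≡d+s) (ℕP.+-monoʳ-≤ d s≤y)
      rearrange : ∀ {e} → e ≡ r + s → e + (y ∸ s) + e ≡ e + y + r
      rearrange refl = trans (shuffle r s (y ∸ s)) (cong (λ z → r + s + z + r) [y∸s]+s≡y)
        where
        shuffle : ∀ r s t → r + s + t + (r + s) ≡ r + s + (t + s) + r
        shuffle = ℕ-Solver.solve-∀
      unique : ∀ {x} → x < d → σ (d + x) ≡ d + y → x ≡ y ∸ s
      unique {x} x<d σ≡ with x ℕP.<? r
      ... | yes x<r = trans (sym (ℕP.m+n∸n≡m x s)) (cong (_∸ s) x+s≡y)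
        where
        x+s≡y : x + s ≡ y
        x+s≡y = ℕP.+-cancelˡ-≡ d _ _ (trans (sym (σ-wrap x<r)) σ≡)
      ... | no x≮r = ⊥-elim (ℕP.<⇒≱ x∸r<s (subst (s ≤_) (sym x∸r≡y) s≤y))
        where
        r≤x = ℕP.≮⇒≥ x≮r
        x∸r≡y : x ∸ r ≡ y
        x∸r≡y = ℕP.+-cancelˡ-≡ d _ _ (trans (sym (σ-shift r≤x)) σ≡)
        x∸r<s : x ∸ r < s
        x∸r<s = subst (x ∸ r <_) (ℕP.m+n∸m≡n r s) (ℕP.∸-monoˡ-< (subst (x <_) d≡r+s x<d) r≤x)

    preimage : ∀ {y} → y < d → Preimage y
    preimage {y} y<d with y ℕP.<? s
    ... | yes y<s = preimage-shift y<s
    ... | no  y≮s = preimage-wrap (ℕP.≮⇒≥ y≮s) y<d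

    σ-column-sum : ∀ {y} (π : Preimage y) →
                   sum (λ (i : Fin d) → + (d + toℕ i) ℤ.* χ (d + y ℕP.≟ σ (d + toℕ i)))
                   ≡ + (d + Preimage.index π)
    σ-column-sum {y} π = begin
      sum (λ (i : Fin d) → g (toℕ i))
        ≡⟨ sum-single-toℕ ℤP.+-0-commutativeMonoid g index<d vanish ⟩
      + (d + index) ℤ.* χ (d + y ℕP.≟ σ (d + index))
        ≡⟨ cong (λ z → + (d + index) ℤ.* z) (χ-yes (d + y ℕP.≟ σ (d + index)) (sym σ-index)) ⟩
      + (d + index) ℤ.* + 1
        ≡⟨ ℤP.*-identityʳ (+ (d + index)) ⟩
      + (d + index)
        ∎
      where
      open ≡-Reasoning
      open Preimage π
      g : ℕ → ℤ
      g x = + (d + x) ℤ.* χ (d + y ℕP.≟ σ (d + x))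
      vanish : ∀ x → x < d → x ≢ index → g x ≡ + 0
      vanish x x<d x≢index =
        trans (cong (λ z → + (d + x) ℤ.* z) (χ-no (d + y ℕP.≟ σ (d + x)) (x≢index ∘ unique x<d ∘ sym)))
              (ℤP.*-zeroʳ (+ (d + x)))

    diagonal-column-sum : ∀ {y} → y < d →
                          sum (λ (i : Fin d) → ℤ.- + (d + toℕ i) ℤ.* χ (d + y ℕP.≟ d + toℕ i))
                          ≡ ℤ.- + (d + y)
    diagonal-column-sum {y} y<d = begin
      sum (λ (i : Fin d) → g (toℕ i))
        ≡⟨ sum-single-toℕ ℤP.+-0-commutativeMonoid g y<d vanish ⟩
      ℤ.- + (d + y) ℤ.* χ (d + y ℕP.≟ d + y)
        ≡⟨ cong (λ z → ℤ.- + (d + y) ℤ.* z) (χ-yes (d + y ℕP.≟ d + y) refl) ⟩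
      ℤ.- + (d + y) ℤ.* + 1
        ≡⟨ ℤP.*-identityʳ (ℤ.- + (d + y)) ⟩
      ℤ.- + (d + y)
        ∎
      where
      open ≡-Reasoning
      g : ℕ → ℤ
      g x = ℤ.- + (d + x) ℤ.* χ (d + y ℕP.≟ d + x)
      vanish : ∀ x → x < d → x ≢ y → g x ≡ + 0
      vanish x _ x≢y =
        trans (cong (λ z → ℤ.- + (d + x) ℤ.* z) (χ-no (d + y ℕP.≟ d + x) (x≢y ∘ sym ∘ ℕP.+-cancelˡ-≡ d _ _)))
              (ℤP.*-zeroʳ (ℤ.- + (d + x)))

    top-column-sum : ∀ z → sum (λ (i : Fin d) → + (d + toℕ i) ℤ.* χ (d + toℕ i ℕP.≟ d) ℤ.* z)
                           ≡ + d ℤ.* z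
    top-column-sum z = begin
      sum (λ (i : Fin d) → g (toℕ i))
        ≡⟨ sum-single-toℕ ℤP.+-0-commutativeMonoid g (ℕP.<-≤-trans 0<r r≤d) vanish ⟩
      + (d + 0) ℤ.* χ (d + 0 ℕP.≟ d) ℤ.* z
        ≡⟨ cong (λ a → + (d + 0) ℤ.* a ℤ.* z) (χ-yes (d + 0 ℕP.≟ d) (ℕP.+-identityʳ d)) ⟩
      + (d + 0) ℤ.* + 1 ℤ.* z
        ≡⟨ cong (ℤ._* z) (ℤP.*-identityʳ (+ (d + 0))) ⟩
      + (d + 0) ℤ.* z
        ≡⟨ cong (λ a → + a ℤ.* z) (ℕP.+-identityʳ d) ⟩
      + d ℤ.* z
        ∎
      where
      open ≡-Reasoning
      g : ℕ → ℤ
      g x = + (d + x) ℤ.* χ (d + x ℕP.≟ d) ℤ.* z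
      vanish : ∀ x → x < d → x ≢ 0 → g x ≡ + 0
      vanish x _ x≢0 = begin
        + (d + x) ℤ.* χ (d + x ℕP.≟ d) ℤ.* z
          ≡⟨ cong (λ a → + (d + x) ℤ.* a ℤ.* z) (χ-no (d + x ℕP.≟ d) d+x≢d) ⟩
        + (d + x) ℤ.* + 0 ℤ.* z
          ≡⟨ cong (ℤ._* z) (ℤP.*-zeroʳ (+ (d + x))) ⟩
        + 0 ℤ.* z
          ≡⟨ ℤP.*-zeroˡ z ⟩
        + 0
          ∎
        where
        d+x≢d : d + x ≢ d
        d+x≢d e = x≢0 (ℕP.+-cancelˡ-≡ d x 0 (trans e (sym (ℕP.+-identityʳ d))))

    column-sum : ∀ {y} → y < d →
                 sum (λ (i : Fin d) → + (d + toℕ i) ℤ.* entry B r (d + toℕ i) (d + y)) ≡ + r ℤ.* + (d + y)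
    column-sum {y} y<d = begin
      sum (λ i → + J i ℤ.* entry B r (J i) K)
        ≡⟨ sum-cong-≗ spread ⟩
      sum (λ i → + K ℤ.* (a i ℤ.+ b i ℤ.+ e i))
        ≡⟨ *-distribˡ-sum (+ K) (λ i → a i ℤ.+ b i ℤ.+ e i) ⟨
      + K ℤ.* sum (λ i → a i ℤ.+ b i ℤ.+ e i)
        ≡⟨ cong (+ K ℤ.*_) (trans (∑-distrib-+ (λ i → a i ℤ.+ b i) e) (cong (ℤ._+ sum e) (∑-distrib-+ a b))) ⟩
      + K ℤ.* (sum a ℤ.+ sum b ℤ.+ sum e)
        ≡⟨ cong (+ K ℤ.*_) (cong₂ ℤ._+_ (cong₂ ℤ._+_ (σ-column-sum π) (diagonal-column-sum y<d))
                                         (top-column-sum (χ (c ℕP.≤? K)))) ⟩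
      + K ℤ.* (+ (d + Preimage.index π) ℤ.+ ℤ.- + K ℤ.+ + d ℤ.* χ (c ℕP.≤? K))
        ≡⟨ cancel (+ (d + Preimage.index π)) (+ d ℤ.* χ (c ℕP.≤? K)) (+ r) (Preimage.balance π) ⟩
      + r ℤ.* + K
        ∎
      where
      open ≡-Reasoning
      K : ℕ
      K = d + y
      J : Fin d → ℕ
      J i = d + toℕ i
      a b e : Fin d → ℤ
      a i = + J i ℤ.* χ (K ℕP.≟ σ (J i))
      b i = ℤ.- + J i ℤ.* χ (K ℕP.≟ J i)
      e i = + J i ℤ.* χ (J i ℕP.≟ d) ℤ.* χ (c ℕP.≤? K)
      π = preimage y<d
      spread : ∀ i → + J i ℤ.* entry B r (J i) K ≡ + K ℤ.* (a i ℤ.+ b i ℤ.+ e i)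
      spread i = trans (cong (+ J i ℤ.*_) (entry≡k*shape (ℕP.m≤m+n d (toℕ i)) (d+x≤B (toℕ<n i)) (d+x≤B y<d)))
                       (distribute (+ J i) (+ K) (χ (K ℕP.≟ σ (J i))) (χ (K ℕP.≟ J i)) (χ (J i ℕP.≟ d)) (χ (c ℕP.≤? K)))
        where
        distribute : ∀ j k α β γ δ → j ℤ.* (k ℤ.* (α ℤ.- β ℤ.+ γ ℤ.* δ))
                                     ≡ k ℤ.* (j ℤ.* α ℤ.+ ℤ.- j ℤ.* β ℤ.+ j ℤ.* γ ℤ.* δ)
        distribute = solve-∀
      cancel : ∀ P X R → P ℤ.+ X ≡ + K ℤ.+ R → + K ℤ.* (P ℤ.+ ℤ.- + K ℤ.+ X) ≡ R ℤ.* + K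
      cancel P X R P+X≡K+R =
        trans (regroup P (+ K) X) (trans (cong (λ z → + K ℤ.* (z ℤ.+ ℤ.- + K)) P+X≡K+R) (drop (+ K) R))
        where
        regroup : ∀ P K X → K ℤ.* (P ℤ.+ ℤ.- K ℤ.+ X) ≡ K ℤ.* (P ℤ.+ X ℤ.+ ℤ.- K)
        regroup = solve-∀
        drop : ∀ K R → K ℤ.* (K ℤ.+ R ℤ.+ ℤ.- K) ≡ R ℤ.* K
        drop = solve-∀

open LinearAlgebra using (leftEigenvector⇒eigenvalue)
open ColumnSums using (column-sum)
module ℤΣ = SemiringSum ℤP.+-*-semiring

dOf-odd : ∀ {B} → B ℕ.% 2 ≡ 1 → suc B ≡ dOf B ℕ.+ dOf B
dOf-odd {B} B%2≡1 = trans B+1≡2[q+1] (cong (λ d → d ℕ.+ d) (sym d≡q+1))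
  where
  q = B ℕ./ 2
  B+1≡2[q+1] : suc B ≡ suc q ℕ.+ suc q
  B+1≡2[q+1] = trans (cong suc (trans (DivMod.m≡m%n+[m/n]*n B 2) (cong (ℕ._+ q ℕ.* 2) B%2≡1))) (double q)
    where
    double : ∀ q → suc (1 ℕ.+ q ℕ.* 2) ≡ suc q ℕ.+ suc q
    double = ℕ-Solver.solve-∀
  d≡q+1 : dOf B ≡ suc q
  d≡q+1 = trans (cong (ℕ._/ 2) (trans B+1≡2[q+1] (twice (suc q)))) (DivMod.m*n/n≡m (suc q) 2)
    where
    twice : ∀ m → m ℕ.+ m ≡ m ℕ.* 2
    twice = ℕ-Solver.solve-∀

fromℤ : ℤ → ℚ
fromℤ z = z ℚ./ 1

fromℤ≡mkℚ : ∀ z → fromℤ z ≡ ℚ.mkℚ z 0 (Coprime.sym (Coprime.1-coprimeTo ℤ.∣ z ∣))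
fromℤ≡mkℚ (+ n)      = ℚP.normalize-coprime (Coprime.sym (Coprime.1-coprimeTo n))
fromℤ≡mkℚ ℤ.-[1+ n ] = cong ℚ.-_ (ℚP.normalize-coprime (Coprime.sym (Coprime.1-coprimeTo (suc n))))

fromℤ-+ : ∀ x y → fromℤ (x ℤ.+ y) ≡ fromℤ x ℚ.+ fromℤ y
fromℤ-+ x y = trans (cong fromℤ (sym (cong₂ ℤ._+_ (ℤP.*-identityʳ x) (ℤP.*-identityʳ y))))
                    (sym (cong₂ ℚ._+_ (fromℤ≡mkℚ x) (fromℤ≡mkℚ y)))

fromℤ-* : ∀ x y → fromℤ (x ℤ.* y) ≡ fromℤ x ℚ.* fromℤ y
fromℤ-* x y = sym (cong₂ ℚ._*_ (fromℤ≡mkℚ x) (fromℤ≡mkℚ y))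

∑-fromℤ-* : ∀ {n} (f g : Fin n → ℤ) →
            ∑ (λ i → fromℤ (f i) ℚ.* fromℤ (g i)) ≡ fromℤ (ℤΣ.sum (λ i → f i ℤ.* g i))
∑-fromℤ-* {zero}  f g = refl
∑-fromℤ-* {suc n} f g = begin
  fromℤ (f zero) ℚ.* fromℤ (g zero) ℚ.+ ∑ (λ i → fromℤ (f (suc i)) ℚ.* fromℤ (g (suc i)))
    ≡⟨ cong₂ ℚ._+_ (sym (fromℤ-* (f zero) (g zero))) (∑-fromℤ-* (f ∘ suc) (g ∘ suc)) ⟩
  fromℤ (f zero ℤ.* g zero) ℚ.+ fromℤ (ℤΣ.sum (λ i → f (suc i) ℤ.* g (suc i)))
    ≡⟨ fromℤ-+ (f zero ℤ.* g zero) _ ⟨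
  fromℤ (ℤΣ.sum (λ i → f i ℤ.* g i))
    ∎
  where open ≡-Reasoning

fromℤ-positive : ∀ n → 0 < n → 0ℚ ℚ.< fromℤ (+ n)
fromℤ-positive n 0<n = ℚP.positive⁻¹ (fromℤ (+ n)) {{ℚP.normalize-pos n 1 {{_}} {{ℕ.>-nonZero 0<n}}}}

index-vector : (B : ℕ) → Fin (dOf B) → ℚ
index-vector B i = fromℤ (+ (dOf B ℕ.+ toℕ i))

index-vector-positive : ∀ B i → 0ℚ ℚ.< index-vector B i
index-vector-positive B i =
  fromℤ-positive (dOf B ℕ.+ toℕ i) (ℕP.<-≤-trans (ℕP.≤-<-trans z≤n (toℕ<n i)) (ℕP.m≤m+n (dOf B) (toℕ i)))

index-vector-left-eigen : ∀ {B r s} → dOf B ≡ r ℕ.+ s → suc B ≡ dOf B ℕ.+ dOf B → 0 < r → 0 < s →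
                          ∀ k → vecMul (index-vector B) (A B r) k ≡ fromℤ (+ r) ℚ.* index-vector B k
index-vector-left-eigen {B} {r} d≡r+s B+1≡d+d 0<r 0<s k = begin
  ∑ (λ i → fromℤ (+ J i) ℚ.* fromℤ (entry B r (J i) (J k)))
    ≡⟨ ∑-fromℤ-* (λ i → + J i) (λ i → entry B r (J i) (J k)) ⟩
  fromℤ (ℤΣ.sum (λ i → + J i ℤ.* entry B r (J i) (J k)))
    ≡⟨ cong fromℤ (column-sum d≡r+s B+1≡d+d 0<r 0<s (toℕ<n k)) ⟩
  fromℤ (+ r ℤ.* + J k)
    ≡⟨ fromℤ-* (+ r) (+ J k) ⟩
  fromℤ (+ r) ℚ.* fromℤ (+ J k)
    ∎
  where
  open ≡-Reasoning
  J : Fin (dOf B) → ℕ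
  J i = dOf B ℕ.+ toℕ i

open import Data.Nat using (_*_; _%_)

lemma3 : (B r : ℕ) → B % 2 ≡ 1 → 3 ≤ B → 1 ≤ r → 2 * r < B →
    IsEigenvalue (A B r) (+ r ℚ./ 1)
    × (∃ λ w → (∀ i → 0ℚ ℚ.< w i) × IsLeftEigenvector (A B r) (+ r ℚ./ 1) w)
-- The hypothesis 3 ≤ B is implied by 1 ≤ r and 2 r < B.
lemma3 B r B%2≡1 _ 0<r 2r<B =
  leftEigenvector⇒eigenvalue (A B r) (fromℤ (+ r)) (index-vector B) left-eigenvector ,
  index-vector B , index-vector-positive B , left-eigenvector
  where
  B+1≡d+d : suc B ≡ dOf B ℕ.+ dOf B
  B+1≡d+d = dOf-odd B%2≡1
  r<d : r < dOf B
  r<d = ℕP.*-cancelˡ-< 2 r (dOf B) (ℕP.<-trans 2r<B (subst (B <_) (trans B+1≡d+d d+d≡2d) (ℕP.n<1+n B)))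
    where
    d+d≡2d : dOf B ℕ.+ dOf B ≡ 2 * dOf B
    d+d≡2d = cong (dOf B ℕ.+_) (sym (ℕP.+-identityʳ (dOf B)))
  nonzero : NonZeroVec (index-vector B)
  nonzero = fromℕ< (ℕP.≤-<-trans z≤n r<d) , λ w≡0 → ℚP.<-irrefl (sym w≡0) (index-vector-positive B _)
  left-eigenvector : IsLeftEigenvector (A B r) (fromℤ (+ r)) (index-vector B)
  left-eigenvector = nonzero ,
    index-vector-left-eigen (sym (ℕP.m+[n∸m]≡n (ℕP.<⇒≤ r<d))) B+1≡d+d 0<r (ℕP.m<n⇒0<n∸m r<d)
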